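{- For every integer $k\ge 2$, $H(n,2k)\ge n^{\frac{1}{k}n-o(n)}$ as $n\to\infty$, where $o(n)$ denotes a function $f(n)$ (depending on $k$) with $f(n)/n\to 0$.
   Context: Two graphs $H_1,H_2$ on the same vertex set are called $C_\ell$-creating if their union contains a cycle of length $\ell$ as a subgraph. $H(n,\ell)$ denotes the maximum number of pairwise $C_\ell$-creating paths (of arbitrary length) on the vertex set $[n]$; equivalently, the maximum number of pairwise $C_\ell$-creating Hamiltonian paths of $K_n$. -}

module Defs where

open import Data.Nat using (ℕ; zero; suc; _*_; _^_; _≤_)
open import Data.Fin using (Fin; toℕ; inject₁; fromℕ)
open import Data.Product using (Σ; ∃-syntax; _×_)
open import Data.Sum using (_⊎_)
open import Data.Empty using (⊥)
open import Relation.Binary.PropositionalEquality using (_≡_; _≢_)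
open import Function.Definitions using (Injective)

Graph : ℕ → Set₁
Graph n = Fin n → Fin n → Set

record HamPath (n : ℕ) : Set where
  constructor hamPath
  field
    seq : Fin n → Fin n
    seq-inj : Injective _≡_ _≡_ seq
open HamPath public

PathAdj : {n : ℕ} → HamPath n → Graph n
PathAdj {n} P u v =
  ∃[ i ] ∃[ j ] (toℕ {n} j ≡ suc (toℕ {n} i)) ×
    ((seq P i ≡ u × seq P j ≡ v) ⊎ (seq P i ≡ v × seq P j ≡ u))

_∪G_ : {n : ℕ} → Graph n → Graph n → Graph n
(G ∪G H) u v = G u v ⊎ H u v

-- G contains a cycle of length ℓ as a subgraph: ℓ distinct vertices
-- c 0, ..., c (ℓ-1) with c i ~ c (i+1) and c (ℓ-1) ~ c 0.
-- (Only meaningful for ℓ ≥ 3; we use it with ℓ = 2k ≥ 4.)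
HasCycle : {n : ℕ} → Graph n → ℕ → Set
HasCycle G zero = ⊥
HasCycle {n} G (suc m) =
  Σ (Fin (suc m) → Fin n) λ c →
    Injective _≡_ _≡_ c ×
    ((i : Fin m) → G (c (inject₁ i)) (c (Data.Fin.suc i))) ×
    G (c (fromℕ m)) (c Data.Fin.zero)

Creating : {n : ℕ} → ℕ → HamPath n → HamPath n → Set
Creating ℓ P Q = HasCycle (PathAdj P ∪G PathAdj Q) ℓ

-- A family of N pairwise C_ℓ-creating Hamiltonian paths of K_n.
-- (Distinct members automatically differ as graphs, since a path united with
-- itself contains no cycle.)
CreatingFamily : (n ℓ N : ℕ) → Set
CreatingFamily n ℓ N =
  Σ (Fin N → HamPath n) λ F → (i j : Fin N) → i ≢ j → Creating ℓ (F i) (F j)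

H≥ : (n ℓ N : ℕ) → Set
H≥ n ℓ N = CreatingFamily n ℓ N

module Submission where

-- Cut the first t·K positions (t·K < n) into t blocks of K and write a position as r + a·K with r < K;
-- offset 0 is the anchor of block a. For a permutation π of the blocks, the path puts the vertex
-- r + π(a)·K at position r + a·K when r ≠ 0 and leaves every other position fixed, so it passes through
-- the anchors in order and between the anchors s·K and (s+1)·K runs through the interior of block π(s).
-- If π₁(s) ≠ π₂(s), these two segments share their ends and have disjoint interiors, so together they
-- close a cycle of length 2K. The t! permutations thus give t! pairwise C_2K-creating paths; with
-- t = ⌊(n-1)/k⌋ and q = ⌊t/m⌋, the bound t! ≥ q^(t-q) gives n^(n(m-k)) ≤ (t!)^(mk) once q is large
-- compared with (2mk)^(2m).

open import Defs
open import Data.Nat using (ℕ; _*_; _^_; _∸_; _≤_; _<_)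
open import Data.Product using (∃-syntax; _×_)

open import Data.Nat
  using (zero; suc; _+_; _!; _%_; _/_; _≤?_; _<?_; NonZero; z≤n; s≤s; z<s; >-nonZero; >-nonZero⁻¹)
open import Data.Nat.Properties
open import Data.Nat.DivMod
  using (m≡m%n+[m/n]*n; m%n<n; [m+kn]%n≡m%n; m<n⇒m%n≡m; m/n*n≤m; m*n/n≡m; /-monoˡ-≤)
open import Data.Nat.Tactic.RingSolver using (solve-∀)
open import Data.Fin as Fin
  using (Fin; toℕ; fromℕ<; fromℕ; inject₁; punchIn; quotient; remainder; remQuot; combine)
open import Data.Fin.Properties
  using (toℕ-injective; toℕ<n; toℕ-fromℕ<; fromℕ<-toℕ; fromℕ<-injective; toℕ-inject₁; toℕ-fromℕ;
         punchIn-injective; punchInᵢ≢i; combine-remQuot; ¬∀⟶∃¬)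
open import Data.Product using (_,_; proj₁; proj₂; uncurry)
open import Data.Sum as Sum using (inj₁; inj₂)
open import Data.Empty using (⊥-elim)
open import Function using (_∘_)
open import Function.Definitions using (Injective)
open import Relation.Nullary using (yes; no; contradiction)
open import Relation.Binary.PropositionalEquality
  using (_≡_; _≢_; refl; sym; trans; cong; cong₂; subst; subst₂; module ≡-Reasoning)

remQuot-injective : ∀ {m} k {i j : Fin (m * k)} → remQuot {m} k i ≡ remQuot k j → i ≡ j
remQuot-injective {m} k {i} {j} eq = begin
  i                                 ≡⟨ combine-remQuot {m} k i ⟨
  uncurry combine (remQuot {m} k i) ≡⟨ cong (uncurry combine) eq ⟩
  uncurry combine (remQuot {m} k j) ≡⟨ combine-remQuot {m} k j ⟩
  j                                 ∎
  where open ≡-Reasoning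

lehmer : ∀ t → Fin (t !) → Fin t → Fin t
lehmer (suc t) c Fin.zero    = quotient {suc t} (t !) c
lehmer (suc t) c (Fin.suc x) =
  punchIn (quotient {suc t} (t !) c) (lehmer t (remainder {suc t} (t !) c) x)

lehmer-injective : ∀ t c → Injective _≡_ _≡_ (lehmer t c)
lehmer-injective (suc t) c {Fin.zero}  {Fin.zero}  _  = refl
lehmer-injective (suc t) c {Fin.zero}  {Fin.suc y} eq = ⊥-elim (punchInᵢ≢i _ _ (sym eq))
lehmer-injective (suc t) c {Fin.suc x} {Fin.zero}  eq = ⊥-elim (punchInᵢ≢i _ _ eq)
lehmer-injective (suc t) c {Fin.suc x} {Fin.suc y} eq =
  cong Fin.suc (lehmer-injective t _ (punchIn-injective _ _ _ eq))

lehmer-code-injective : ∀ t {c d} → (∀ x → lehmer t c x ≡ lehmer t d x) → c ≡ d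
lehmer-code-injective zero    {Fin.zero} {Fin.zero} _ = refl
lehmer-code-injective (suc t) {c} {d} same =
  remQuot-injective {suc t} (t !) (cong₂ _,_ same-quotient same-remainder)
  where
  same-quotient : quotient {suc t} (t !) c ≡ quotient (t !) d
  same-quotient = same Fin.zero
  same-remainder : remainder {suc t} (t !) c ≡ remainder (t !) d
  same-remainder = lehmer-code-injective t λ x →
    punchIn-injective _ _ _ (trans (same (Fin.suc x)) (cong (λ a → punchIn a _) (sym same-quotient)))

lehmer-separates : ∀ t {c d} → c ≢ d → ∃[ s ] lehmer t c s ≢ lehmer t d s
lehmer-separates t {c} {d} c≢d =
  ¬∀⟶∃¬ t _ (λ s → lehmer t c s Fin.≟ lehmer t d s) (c≢d ∘ lehmer-code-injective t)

extendℕ : ∀ {t} → (Fin t → Fin t) → ℕ → ℕ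
extendℕ {t} π a with a <? t
... | yes a<t = toℕ (π (fromℕ< a<t))
... | no _    = a

extendℕ-toℕ : ∀ {t} (π : Fin t → Fin t) x → extendℕ π (toℕ x) ≡ toℕ (π x)
extendℕ-toℕ {t} π x with toℕ x <? t
... | yes x<t = cong (toℕ ∘ π) (fromℕ<-toℕ x x<t)
... | no x≮t  = contradiction (toℕ<n x) x≮t

extendℕ-< : ∀ {t} (π : Fin t → Fin t) {a} → a < t → extendℕ π a < t
extendℕ-< {t} π {a} a<t with a <? t
... | yes _   = toℕ<n _
... | no a≮t  = contradiction a<t a≮t

extendℕ-≥ : ∀ {t} (π : Fin t → Fin t) {a} → t ≤ a → extendℕ π a ≡ a
extendℕ-≥ {t} π {a} t≤a with a <? t
... | yes a<t = contradiction t≤a (<⇒≱ a<t)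
... | no _    = refl

extendℕ-injective : ∀ {t} (π : Fin t → Fin t) → Injective _≡_ _≡_ π → Injective _≡_ _≡_ (extendℕ π)
extendℕ-injective {t} π π-inj {a} {b} eq with a <? t | b <? t
... | yes a<t | yes b<t = fromℕ<-injective a b a<t b<t (π-inj (toℕ-injective eq))
... | yes _   | no b≮t  = contradiction (subst (_< t) eq (toℕ<n _)) b≮t
... | no a≮t  | yes _   = contradiction (subst (_< t) (sym eq) (toℕ<n _)) a≮t
... | no _    | no _    = eq

record PathMap (n : ℕ) : Set where
  field
    at : ℕ → ℕ
    at-injective : Injective _≡_ _≡_ at
    at-< : ∀ {p} → p < n → at p < n
open PathMap

Linked : ∀ {n} → Graph n → ℕ → ℕ → Set
Linked G a b = ∀ {u v} → toℕ u ≡ a → toℕ v ≡ b → G u v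

module _ {n} (P : PathMap n) where

  toHamPath : HamPath n
  toHamPath = hamPath vertex vertex-injective
    where
    vertex : Fin n → Fin n
    vertex i = fromℕ< (at-< P (toℕ<n i))
    vertex-injective : Injective _≡_ _≡_ vertex
    vertex-injective {i} {j} eq = toℕ-injective (at-injective P
      (trans (sym (toℕ-fromℕ< _)) (trans (cong toℕ eq) (toℕ-fromℕ< _))))

  toHamPath-linked : ∀ {p} → suc p < n → Linked (PathAdj toHamPath) (at P p) (at P (suc p))
  toHamPath-linked {p} 1+p<n u≡ v≡ =
    fromℕ< p<n , fromℕ< 1+p<n , trans (toℕ-fromℕ< 1+p<n) (cong suc (sym (toℕ-fromℕ< p<n))) ,
    inj₁ (seq-at p<n u≡ , seq-at 1+p<n v≡)
    where
    p<n : p < n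
    p<n = <⇒≤ 1+p<n
    seq-at : ∀ {q} (q<n : q < n) {w} → toℕ w ≡ at P q → seq toHamPath (fromℕ< q<n) ≡ w
    seq-at q<n w≡ = toℕ-injective (trans (toℕ-fromℕ< _) (trans (cong (at P) (toℕ-fromℕ< q<n)) (sym w≡)))

PathAdj-sym : ∀ {n} (P : HamPath n) {u v} → PathAdj P u v → PathAdj P v u
PathAdj-sym P (i , j , j≡1+i , ends) = i , j , j≡1+i , Sum.swap ends

closedWalk⇒HasCycle : ∀ {n} (G : Graph n) ℓ .{{_ : NonZero ℓ}} (c : ℕ → ℕ) →
  (∀ {i} → i < ℓ → c i < n) →
  (∀ {i j} → i < ℓ → j < ℓ → c i ≡ c j → i ≡ j) →
  (∀ {i} → i < ℓ → Linked G (c i) (c (suc i))) →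
  c ℓ ≡ c 0 →
  HasCycle G ℓ
closedWalk⇒HasCycle {n} G (suc M) c c-< c-injective c-linked closes =
  vertex , vertex-injective , step , closing
  where
  vertex : Fin (suc M) → Fin n
  vertex i = fromℕ< (c-< (toℕ<n i))
  toℕ-vertex : ∀ i → toℕ (vertex i) ≡ c (toℕ i)
  toℕ-vertex i = toℕ-fromℕ< _
  vertex-injective : Injective _≡_ _≡_ vertex
  vertex-injective {i} {j} eq = toℕ-injective (c-injective (toℕ<n i) (toℕ<n j)
    (trans (sym (toℕ-vertex i)) (trans (cong toℕ eq) (toℕ-vertex j))))
  step : (i : Fin M) → G (vertex (inject₁ i)) (vertex (Fin.suc i))
  step i = c-linked (m<n⇒m<1+n (toℕ<n i))
    (trans (toℕ-vertex (inject₁ i)) (cong c (toℕ-inject₁ i))) (toℕ-vertex (Fin.suc i))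
  closing : G (vertex (fromℕ M)) (vertex Fin.zero)
  closing = c-linked ≤-refl
    (trans (toℕ-vertex (fromℕ M)) (cong c (toℕ-fromℕ M))) (trans (toℕ-vertex Fin.zero) (sym closes))

module _ {n} (P Q : PathMap n) (p L : ℕ) .{{_ : NonZero L}}
  (L+p<n : L + p < n)
  (meet-start : at P p ≡ at Q p)
  (meet-end : at P (L + p) ≡ at Q (L + p))
  (interiors-apart : ∀ {i j} → 0 < i → i < L → 0 < j → j < L → at P (i + p) ≢ at Q (j + p))
  where

  private
    walk : ℕ → ℕ
    walk i with i ≤? L
    ... | yes _ = at P (i + p)
    ... | no _  = at Q (L + L ∸ i + p)

    walk-out : ∀ {i} → i ≤ L → walk i ≡ at P (i + p)
    walk-out {i} i≤L with i ≤? L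
    ... | yes _  = refl
    ... | no i≰L = contradiction i≤L i≰L

    walk-back : ∀ j → walk (L + j) ≡ at Q (L ∸ j + p)
    walk-back zero = begin
      walk (L + 0)     ≡⟨ cong walk (+-identityʳ L) ⟩
      walk L           ≡⟨ walk-out ≤-refl ⟩
      at P (L + p)     ≡⟨ meet-end ⟩
      at Q (L ∸ 0 + p) ∎
      where open ≡-Reasoning
    walk-back (suc j) with L + suc j ≤? L
    ... | yes L+1+j≤L = contradiction L+1+j≤L (m+1+n≰m L)
    ... | no _        = cong (λ x → at Q (x + p)) ([m+n]∸[m+o]≡n∸o L L (suc j))

    data Index : ℕ → Set where
      outward  : ∀ {i} → i ≤ L → Index i
      backward : ∀ {j} → suc j < L → Index (L + suc j)

    index : ∀ {i} → i < 2 * L → Index i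
    index {i} i<2L with i ≤? L
    ... | yes i≤L = outward i≤L
    ... | no i≰L with j , refl ← m≤n⇒∃[o]m+o≡n (≰⇒> i≰L) =
      subst Index (+-suc L j) (backward (+-cancelˡ-< L (suc j) L L+1+j<L+L))
      where
      L+1+j<L+L : L + suc j < L + L
      L+1+j<L+L = subst₂ _<_ (sym (+-suc L j)) (cong (L +_) (+-identityʳ L)) i<2L

    at-Q-injective : ∀ {a b} → at Q (a + p) ≡ at Q (b + p) → a ≡ b
    at-Q-injective = +-cancelʳ-≡ p _ _ ∘ at-injective Q

    L∸1+j<L : ∀ {j} → suc j < L → L ∸ suc j < L
    L∸1+j<L 1+j<L = ∸-monoʳ-< z<s (<⇒≤ 1+j<L)

    outward≢backward : ∀ {i j} → i ≤ L → suc j < L → at P (i + p) ≢ at Q (L ∸ suc j + p)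
    outward≢backward {zero} _ 1+j<L eq =
      <⇒≢ (m<n⇒0<n∸m 1+j<L) (at-Q-injective (trans (sym meet-start) eq))
    outward≢backward {suc i} 1+i≤L 1+j<L eq with m≤n⇒m<n∨m≡n 1+i≤L
    ... | inj₁ 1+i<L = interiors-apart z<s 1+i<L (m<n⇒0<n∸m 1+j<L) (L∸1+j<L 1+j<L) eq
    ... | inj₂ refl  = <⇒≢ (L∸1+j<L 1+j<L) (sym (at-Q-injective (trans (sym meet-end) eq)))

    walk-injective : ∀ {i i′} → i < 2 * L → i′ < 2 * L → walk i ≡ walk i′ → i ≡ i′
    walk-injective i< i′< eq with index i< | index i′<
    ... | outward i≤L | outward i′≤L =
      +-cancelʳ-≡ p _ _ (at-injective P (trans (sym (walk-out i≤L)) (trans eq (walk-out i′≤L))))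
    ... | outward i≤L | backward 1+j<L = contradiction
      (trans (sym (walk-out i≤L)) (trans eq (walk-back _))) (outward≢backward i≤L 1+j<L)
    ... | backward 1+j<L | outward i′≤L = contradiction
      (trans (sym (walk-out i′≤L)) (trans (sym eq) (walk-back _))) (outward≢backward i′≤L 1+j<L)
    ... | backward 1+j<L | backward 1+j′<L = cong (L +_) (∸-cancelˡ-≡ (<⇒≤ 1+j<L) (<⇒≤ 1+j′<L)
      (at-Q-injective (trans (sym (walk-back _)) (trans eq (walk-back _)))))

    walk-< : ∀ {i} → i < 2 * L → walk i < n
    walk-< i< with index i<
    ... | outward i≤L =
      subst (_< n) (sym (walk-out i≤L)) (at-< P (≤-<-trans (+-monoˡ-≤ p i≤L) L+p<n))
    ... | backward {j} _ =
      subst (_< n) (sym (walk-back (suc j))) (at-< Q (≤-<-trans (+-monoˡ-≤ p (m∸n≤m L (suc j))) L+p<n))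

    G : Graph n
    G = PathAdj (toHamPath P) ∪G PathAdj (toHamPath Q)

    outward-linked : ∀ {i} → i < L → Linked G (walk i) (walk (suc i))
    outward-linked i<L u≡ v≡ = inj₁ (toHamPath-linked P (≤-<-trans (+-monoˡ-≤ p i<L) L+p<n)
      (trans u≡ (walk-out (<⇒≤ i<L))) (trans v≡ (walk-out i<L)))

    backward-linked : ∀ {j} → j < L → Linked G (walk (L + j)) (walk (suc (L + j)))
    backward-linked {j} j<L {u} {v} u≡ v≡ =
      inj₂ (PathAdj-sym (toHamPath Q) (toHamPath-linked Q 1+x<n v≡at-x u≡at-1+x))
      where
      x : ℕ
      x = L ∸ suc j + p
      1+[L∸1+j]≡L∸j : suc (L ∸ suc j) ≡ L ∸ j
      1+[L∸1+j]≡L∸j = sym (+-∸-assoc 1 j<L)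
      1+x<n : suc x < n
      1+x<n = subst (λ y → y + p < n) (sym 1+[L∸1+j]≡L∸j) (≤-<-trans (+-monoˡ-≤ p (m∸n≤m L j)) L+p<n)
      u≡at-1+x : toℕ u ≡ at Q (suc x)
      u≡at-1+x = trans u≡ (trans (walk-back j) (cong (λ y → at Q (y + p)) (sym 1+[L∸1+j]≡L∸j)))
      v≡at-x : toℕ v ≡ at Q x
      v≡at-x = trans v≡ (trans (cong walk (sym (+-suc L j))) (walk-back (suc j)))

    walk-linked : ∀ {i} → i < 2 * L → Linked G (walk i) (walk (suc i))
    walk-linked {i} i<2L with L ≤? i
    ... | no L≰i = outward-linked (≰⇒> L≰i)
    ... | yes L≤i with j , refl ← m≤n⇒∃[o]m+o≡n L≤i =
      backward-linked (+-cancelˡ-< L j L (subst (L + j <_) (cong (L +_) (+-identityʳ L)) i<2L))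

    walk-closes : walk (2 * L) ≡ walk 0
    walk-closes = begin
      walk (L + (L + 0)) ≡⟨ cong (λ x → walk (L + x)) (+-identityʳ L) ⟩
      walk (L + L)       ≡⟨ walk-back L ⟩
      at Q (L ∸ L + p)   ≡⟨ cong (λ x → at Q (x + p)) (n∸n≡0 L) ⟩
      at Q p             ≡⟨ meet-start ⟨
      at P p             ≡⟨ walk-out z≤n ⟨
      walk 0             ∎
      where open ≡-Reasoning

  disjointDetours⇒Creating : Creating (2 * L) (toHamPath P) (toHamPath Q)
  disjointDetours⇒Creating =
    closedWalk⇒HasCycle _ (2 * L) {{m*n≢0 2 L}} walk walk-< walk-injective walk-linked walk-closes

[m+kn]%n≡m : ∀ {m} k n .{{_ : NonZero n}} → m < n → (m + k * n) % n ≡ m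
[m+kn]%n≡m k n m<n = trans ([m+kn]%n≡m%n _ k n) (m<n⇒m%n≡m m<n)

divMod-unique : ∀ n .{{_ : NonZero n}} {r r′ q q′} → r < n → r′ < n →
  r + q * n ≡ r′ + q′ * n → r ≡ r′ × q ≡ q′
divMod-unique n {r} {r′} {q} {q′} r<n r′<n eq = r≡r′ , q≡q′
  where
  r≡r′ : r ≡ r′
  r≡r′ = trans (sym ([m+kn]%n≡m q n r<n)) (trans (cong (_% n) eq) ([m+kn]%n≡m q′ n r′<n))
  q≡q′ : q ≡ q′
  q≡q′ = *-cancelʳ-≡ q q′ n (+-cancelˡ-≡ r _ _ (trans eq (cong (_+ q′ * n) (sym r≡r′))))

m+kn<ln : ∀ {m k l} n → m < n → k < l → m + k * n < l * n
m+kn<ln {k = k} n m<n k<l = <-≤-trans (+-monoˡ-< (k * n) m<n) (*-monoˡ-≤ n k<l)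

m<[1+m/n]*n : ∀ m n .{{_ : NonZero n}} → m < suc (m / n) * n
m<[1+m/n]*n m n = subst (_< suc (m / n) * n) (sym (m≡m%n+[m/n]*n m n)) (+-monoˡ-< (m / n * n) (m%n<n m n))

m*n≤o⇒m≤o/n : ∀ {m o} n .{{_ : NonZero n}} → m * n ≤ o → m ≤ o / n
m*n≤o⇒m≤o/n {m} n mn≤o = subst (_≤ _ / n) (m*n/n≡m m n) (/-monoˡ-≤ n mn≤o)

relabel : (K : ℕ) .{{_ : NonZero K}} → (ℕ → ℕ → ℕ) → ℕ → ℕ
relabel K φ p = p % K + φ (p % K) (p / K) * K

relabel-on : ∀ K .{{_ : NonZero K}} φ {r} a → r < K → relabel K φ (r + a * K) ≡ r + φ r a * K
relabel-on K φ {r} a r<K = cong₂ (λ r′ a′ → r′ + φ r′ a′ * K) (proj₁ decomposition) (proj₂ decomposition)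
  where
  decomposition : (r + a * K) % K ≡ r × (r + a * K) / K ≡ a
  decomposition = divMod-unique K (m%n<n (r + a * K) K) r<K (sym (m≡m%n+[m/n]*n (r + a * K) K))

relabel-injective : ∀ K .{{_ : NonZero K}} φ → (∀ r → Injective _≡_ _≡_ (φ r)) →
  Injective _≡_ _≡_ (relabel K φ)
relabel-injective K φ φ-injective {p} {q} eq = begin
  p                     ≡⟨ m≡m%n+[m/n]*n p K ⟩
  p % K + p / K * K     ≡⟨ cong₂ (λ r a → r + a * K) %≡ /≡ ⟩
  q % K + q / K * K     ≡⟨ m≡m%n+[m/n]*n q K ⟨
  q                     ∎
  where
  open ≡-Reasoning
  decomposition : p % K ≡ q % K × φ (p % K) (p / K) ≡ φ (q % K) (q / K)
  decomposition = divMod-unique K (m%n<n p K) (m%n<n q K) eq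
  %≡ : p % K ≡ q % K
  %≡ = proj₁ decomposition
  /≡ : p / K ≡ q / K
  /≡ = φ-injective (q % K) (subst (λ r → φ r (p / K) ≡ φ (q % K) (q / K)) %≡ (proj₂ decomposition))

relabel-< : ∀ K .{{_ : NonZero K}} φ {t n} →
  (∀ r {a} → a < t → φ r a < t) → (∀ r {a} → t ≤ a → φ r a ≡ a) →
  t * K ≤ n → ∀ {p} → p < n → relabel K φ p < n
relabel-< K φ {t} {n} φ-< φ-≥ tK≤n {p} p<n with p / K <? t
... | yes p/K<t = <-≤-trans (m+kn<ln K (m%n<n p K) (φ-< _ p/K<t)) tK≤n
... | no p/K≮t = subst (_< n) p≡ p<n
  where
  p≡ : p ≡ relabel K φ p
  p≡ = trans (m≡m%n+[m/n]*n p K) (cong (λ a → p % K + a * K) (sym (φ-≥ _ (≮⇒≥ p/K≮t))))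

shuffleInterior : (ℕ → ℕ) → ℕ → ℕ → ℕ
shuffleInterior π zero    a = a
shuffleInterior π (suc _) a = π a

module _ {n} (K : ℕ) .{{_ : NonZero K}} (t : ℕ) (tK<n : t * K < n) where

  blockPath : (π : Fin t → Fin t) → Injective _≡_ _≡_ π → PathMap n
  blockPath π π-injective = record
    { at           = relabel K (shuffleInterior (extendℕ π))
    ; at-injective = relabel-injective K _ injective
    ; at-<         = relabel-< K _ preserves-< fixes-≥ (<⇒≤ tK<n)
    }
    where
    injective : ∀ r → Injective _≡_ _≡_ (shuffleInterior (extendℕ π) r)
    injective zero    eq = eq
    injective (suc _) eq = extendℕ-injective π π-injective eq
    preserves-< : ∀ r {a} → a < t → shuffleInterior (extendℕ π) r a < t
    preserves-< zero    a<t = a<t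
    preserves-< (suc _) a<t = extendℕ-< π a<t
    fixes-≥ : ∀ r {a} → t ≤ a → shuffleInterior (extendℕ π) r a ≡ a
    fixes-≥ zero    _   = refl
    fixes-≥ (suc _) t≤a = extendℕ-≥ π t≤a

  blockPath-anchor : ∀ π (π-injective : Injective _≡_ _≡_ π) a →
    at (blockPath π π-injective) (a * K) ≡ a * K
  blockPath-anchor π _ a = relabel-on K (shuffleInterior (extendℕ π)) a (>-nonZero⁻¹ K)

  blockPath-interior : ∀ π (π-injective : Injective _≡_ _≡_ π) {r} a → suc r < K →
    at (blockPath π π-injective) (suc r + a * K) ≡ suc r + extendℕ π a * K
  blockPath-interior π _ a 1+r<K = relabel-on K (shuffleInterior (extendℕ π)) a 1+r<K

  blockPaths-creating : ∀ {π₁ π₂} (π₁-injective : Injective _≡_ _≡_ π₁) (π₂-injective : Injective _≡_ _≡_ π₂)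
    {s} → π₁ s ≢ π₂ s →
    Creating (2 * K) (toHamPath (blockPath π₁ π₁-injective)) (toHamPath (blockPath π₂ π₂-injective))
  blockPaths-creating {π₁} {π₂} π₁-inj π₂-inj {s} π₁s≢π₂s =
    disjointDetours⇒Creating P₁ P₂ (toℕ s * K) K block-end<n
      (trans (blockPath-anchor π₁ π₁-inj (toℕ s)) (sym (blockPath-anchor π₂ π₂-inj (toℕ s))))
      (trans (blockPath-anchor π₁ π₁-inj (suc (toℕ s))) (sym (blockPath-anchor π₂ π₂-inj (suc (toℕ s)))))
      interiors-apart
    where
    P₁ P₂ : PathMap n
    P₁ = blockPath π₁ π₁-inj
    P₂ = blockPath π₂ π₂-inj
    block-end<n : K + toℕ s * K < n
    block-end<n = ≤-<-trans (*-monoˡ-≤ K (toℕ<n s)) tK<n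
    interiors-apart : ∀ {i j} → 0 < i → i < K → 0 < j → j < K →
      at P₁ (i + toℕ s * K) ≢ at P₂ (j + toℕ s * K)
    interiors-apart {zero}  ()
    interiors-apart {suc i} {zero}  _ _ ()
    interiors-apart {suc i} {suc j} _ i<K _ j<K eq = π₁s≢π₂s (toℕ-injective (begin
      toℕ (π₁ s)           ≡⟨ extendℕ-toℕ π₁ s ⟨
      extendℕ π₁ (toℕ s)   ≡⟨ proj₂ (divMod-unique K i<K j<K same-vertex) ⟩
      extendℕ π₂ (toℕ s)   ≡⟨ extendℕ-toℕ π₂ s ⟩
      toℕ (π₂ s)           ∎))
      where
      open ≡-Reasoning
      same-vertex : suc i + extendℕ π₁ (toℕ s) * K ≡ suc j + extendℕ π₂ (toℕ s) * K
      same-vertex = trans (sym (blockPath-interior π₁ π₁-inj (toℕ s) i<K))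
                          (trans eq (blockPath-interior π₂ π₂-inj (toℕ s) j<K))

  blockFamily : H≥ n (2 * K) (t !)
  blockFamily = path , creating
    where
    path : Fin (t !) → HamPath n
    path c = toHamPath (blockPath (lehmer t c) (lehmer-injective t c))
    creating : ∀ c d → c ≢ d → Creating (2 * K) (path c) (path d)
    creating c d c≢d =
      blockPaths-creating (lehmer-injective t c) (lehmer-injective t d) (proj₂ (lehmer-separates t c≢d))

^-distribʳ-* : ∀ e a b → (a * b) ^ e ≡ a ^ e * b ^ e
^-distribʳ-* zero    a b = refl
^-distribʳ-* (suc e) a b =
  trans (cong (a * b *_) (^-distribʳ-* e a b)) ([m*n]*[o*p]≡[m*o]*[n*p] a b (a ^ e) (b ^ e))

m^n≤[m+n]! : ∀ m n → m ^ n ≤ (m + n) !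
m^n≤[m+n]! m zero    = subst (λ x → 1 ≤ x !) (sym (+-identityʳ m)) (1≤n! m)
m^n≤[m+n]! m (suc n) = subst (λ x → m * m ^ n ≤ x !) (sym (+-suc m n))
  (*-mono-≤ (m≤n⇒m≤1+n (m≤m+n m n)) (m^n≤[m+n]! m n))

-- (C^m)^2 ≤ q and 1 + q ≤ 2(q ∸ m) let q^(q ∸ m) pay for the factor C^((1+q)j).
[C*q]^[[1+q]*j]≤q^[[1+j]*q] : ∀ C .{{_ : NonZero C}} {q m j} → C ^ m * C ^ m ≤ q → m + m < q → j ≤ m →
  (C * q) ^ (suc q * j) ≤ q ^ (suc j * q)
[C*q]^[[1+q]*j]≤q^[[1+j]*q] C {q} {m} {j} X²≤q 2m<q j≤m = begin
  (C * q) ^ (suc q * j)               ≡⟨ ^-distribʳ-* (suc q * j) C q ⟩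
  C ^ (suc q * j) * q ^ (suc q * j)   ≤⟨ *-mono-≤ C-part q-part ⟩
  q ^ d * q ^ (m + q * j)             ≡⟨ ^-distribˡ-+-* q d (m + q * j) ⟨
  q ^ (d + (m + q * j))               ≡⟨ cong (q ^_) exponent ⟩
  q ^ (suc j * q)                     ∎
  where
  open ≤-Reasoning
  instance
    q≢0 : NonZero q
    q≢0 = >-nonZero (≤-<-trans z≤n 2m<q)
    X≢0 : NonZero (C ^ m)
    X≢0 = m^n≢0 C m
  X d : ℕ
  X = C ^ m
  d = q ∸ m
  m≤q : m ≤ q
  m≤q = ≤-trans (m≤m+n m m) (<⇒≤ 2m<q)
  1+q≤d+d : suc q ≤ d + d
  1+q≤d+d = begin
    suc q       ≡⟨ cong suc (m∸n+n≡m m≤q) ⟨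
    suc (d + m) ≡⟨ +-suc d m ⟨
    d + suc m   ≤⟨ +-monoʳ-≤ d (+-cancelʳ-< m m d (subst (m + m <_) (sym (m∸n+n≡m m≤q)) 2m<q)) ⟩
    d + d       ∎
  C-part : C ^ (suc q * j) ≤ q ^ d
  C-part = begin
    C ^ (suc q * j)  ≤⟨ ^-monoʳ-≤ C (subst (suc q * j ≤_) (*-comm (suc q) m) (*-monoʳ-≤ (suc q) j≤m)) ⟩
    C ^ (m * suc q)  ≡⟨ ^-*-assoc C m (suc q) ⟨
    X ^ suc q        ≤⟨ ^-monoʳ-≤ X 1+q≤d+d ⟩
    X ^ (d + d)      ≡⟨ ^-distribˡ-+-* X d d ⟩
    X ^ d * X ^ d    ≡⟨ ^-distribʳ-* d X X ⟨
    (X * X) ^ d      ≤⟨ ^-monoˡ-≤ d X²≤q ⟩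
    q ^ d            ∎
  q-part : q ^ (suc q * j) ≤ q ^ (m + q * j)
  q-part = ^-monoʳ-≤ q (+-monoˡ-≤ (q * j) j≤m)
  exponent : d + (m + q * j) ≡ suc j * q
  exponent = trans (sym (+-assoc d m (q * j))) (cong₂ _+_ (m∸n+n≡m m≤q) (*-comm q j))

n^[n*[m∸k]]≤t!^[m*k] : ∀ {k m n t q} → 2 ≤ k → k < m →
  (2 * (m * k)) ^ m * (2 * (m * k)) ^ m ≤ q → m + m < q → q * m ≤ t → n ≤ suc q * (m * k) →
  n ^ (n * (m ∸ k)) ≤ (t !) ^ (m * k)
n^[n*[m∸k]]≤t!^[m*k] {k} {m} {n} {t} {q} 2≤k k<m X²≤q 2m<q qm≤t n≤B = begin
  n ^ (n * j)                   ≤⟨ ^-monoˡ-≤ (n * j) n≤B ⟩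
  B ^ (n * j)                   ≤⟨ ^-monoʳ-≤ B (*-monoˡ-≤ j n≤B) ⟩
  B ^ (B * j)                   ≡⟨ cong (B ^_) (regroup (suc q) c j) ⟩
  B ^ (suc q * j * c)           ≡⟨ ^-*-assoc B (suc q * j) c ⟨
  (B ^ (suc q * j)) ^ c         ≤⟨ ^-monoˡ-≤ c (^-monoˡ-≤ (suc q * j) B≤Cq) ⟩
  ((C * q) ^ (suc q * j)) ^ c   ≤⟨ ^-monoˡ-≤ c ([C*q]^[[1+q]*j]≤q^[[1+j]*q] C X²≤q 2m<q (m∸n≤m m k)) ⟩
  (q ^ (suc j * q)) ^ c         ≤⟨ ^-monoˡ-≤ c (^-monoʳ-≤ q (m+n≤o⇒m≤o∸n (suc j * q) [2+j]q≤t)) ⟩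
  (q ^ (t ∸ q)) ^ c             ≤⟨ ^-monoˡ-≤ c (subst (λ x → q ^ (t ∸ q) ≤ x !) (m+[n∸m]≡n q≤t) (m^n≤[m+n]! q (t ∸ q))) ⟩
  (t !) ^ c                     ∎
  where
  open ≤-Reasoning
  c j B C : ℕ
  c = m * k
  j = m ∸ k
  B = suc q * c
  C = 2 * c
  instance
    k≢0 : NonZero k
    k≢0 = >-nonZero (<-≤-trans z<s 2≤k)
    m≢0 : NonZero m
    m≢0 = >-nonZero (≤-<-trans z≤n k<m)
    c≢0 : NonZero c
    c≢0 = m*n≢0 m k
    B≢0 : NonZero B
    B≢0 = m*n≢0 (suc q) c
    C≢0 : NonZero C
    C≢0 = m*n≢0 2 c
    q≢0 : NonZero q
    q≢0 = >-nonZero (≤-<-trans z≤n 2m<q)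
  regroup : ∀ a b d → a * b * d ≡ a * d * b
  regroup = solve-∀
  doubling : ∀ a b → (a + a) * b ≡ 2 * b * a
  doubling = solve-∀
  B≤Cq : B ≤ C * q
  B≤Cq = ≤-trans (*-monoˡ-≤ c (+-monoˡ-≤ q (>-nonZero⁻¹ q))) (≤-reflexive (doubling q c))
  q≤t : q ≤ t
  q≤t = ≤-trans (m≤m*n q m) qm≤t
  [2+j]q≤t : suc j * q + q ≤ t
  [2+j]q≤t = begin
    suc j * q + q    ≡⟨ +-comm (suc j * q) q ⟩
    (2 + j) * q      ≤⟨ *-monoˡ-≤ q (subst (2 + j ≤_) (trans (+-comm k j) (m∸n+n≡m (<⇒≤ k<m))) (+-monoˡ-≤ j 2≤k)) ⟩
    m * q            ≡⟨ *-comm m q ⟩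
    q * m            ≤⟨ qm≤t ⟩
    t                ∎

claim2p1 : (k : ℕ) → 2 ≤ k → (m : ℕ) → k < m →
    ∃[ N₀ ] ((n : ℕ) → N₀ ≤ n →
      ∃[ N ] (H≥ n (2 * k) N × n ^ (n * (m ∸ k)) ≤ N ^ (m * k)))
claim2p1 k 2≤k m k<m = suc (q₀ * m * k) , large-n
  where
  X q₀ : ℕ
  X = (2 * (m * k)) ^ m
  q₀ = X * X + suc (m + m)
  instance
    k≢0 : NonZero k
    k≢0 = >-nonZero (<-≤-trans z<s 2≤k)
    m≢0 : NonZero m
    m≢0 = >-nonZero (≤-<-trans z≤n k<m)
  large-n : (n : ℕ) → suc (q₀ * m * k) ≤ n →
    ∃[ N ] (H≥ n (2 * k) N × n ^ (n * (m ∸ k)) ≤ N ^ (m * k))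
  large-n (suc n) (s≤s q₀mk≤n) = t ! , blockFamily k t (s≤s (m/n*n≤m n k)) ,
    n^[n*[m∸k]]≤t!^[m*k] 2≤k k<m (≤-trans (m≤m+n (X * X) _) q₀≤q) (≤-trans (m≤n+m _ (X * X)) q₀≤q)
      (m/n*n≤m t m) 1+n≤[1+q]mk
    where
    t q : ℕ
    t = n / k
    q = t / m
    q₀≤q : q₀ ≤ q
    q₀≤q = m*n≤o⇒m≤o/n m (m*n≤o⇒m≤o/n k q₀mk≤n)
    1+n≤[1+q]mk : suc n ≤ suc q * (m * k)
    1+n≤[1+q]mk = ≤-trans (m<[1+m/n]*n n k)
      (≤-trans (*-monoˡ-≤ k (m<[1+m/n]*n t m)) (≤-reflexive (*-assoc (suc q) m k)))
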